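{- The theta graph $\theta_{2,3,3}$ is not an $i$-graph, i.e. there is no graph $G$ with $\mathcal{I}(G)\cong\theta_{2,3,3}$.
   Context: For a graph $G$, an $i$-set is an independent dominating set of minimum cardinality. The $i$-graph $\mathcal{I}(G)$ has the $i$-sets as vertices, with $X\sim Y$ iff $Y=(X\setminus\{u\})\cup\{v\}$ for some $u\in X$, $v\notin X$ with $uv\in E(G)$. $\theta_{j,k,\ell}$ denotes two vertices joined by three internally vertex-disjoint paths of lengths $j,k,\ell$. -}

module Defs where

open import Data.Nat using (ℕ; _≤_)
open import Data.Fin using (Fin; #_)
open import Data.Fin.Subset using (Subset; _∈_; _∉_; ∣_∣; inside; outside)
open import Data.Vec using (_[_]≔_)
open import Data.Product using (Σ; ∃; _×_; _,_)
open import Data.Sum using (_⊎_)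
open import Data.List using (List; []; _∷_)
open import Data.List.Membership.Propositional using () renaming (_∈_ to _∈ₗ_)
open import Relation.Nullary using (¬_)
open import Relation.Binary.PropositionalEquality using (_≡_)


record Graph : Set₁ where
  field
    n     : ℕ
    E     : Fin n → Fin n → Set
    sym   : ∀ {u v} → E u v → E v u
    irrefl : ∀ {u} → ¬ E u u

module _ (G : Graph) where
  open Graph G

  Independent : Subset n → Set
  Independent S = ∀ u v → u ∈ S → v ∈ S → ¬ E u v

  Dominating : Subset n → Set
  Dominating S = ∀ v → v ∈ S ⊎ (∃ λ u → u ∈ S × E u v)

  IndDom : Subset n → Set
  IndDom S = Independent S × Dominating S

  IsISet : Subset n → Set
  IsISet S = IndDom S × (∀ T → IndDom T → ∣ S ∣ ≤ ∣ T ∣)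

  IAdj : Subset n → Subset n → Set
  IAdj X Y = ∃ λ u → ∃ λ v → u ∈ X × v ∉ X × E u v
             × Y ≡ ((X [ u ]≔ outside) [ v ]≔ inside)

-- θ_{2,3,3} on Fin 7: endpoints 0 and 1; paths 0-2-1, 0-3-4-1, 0-5-6-1.
θ-edges : List (Fin 7 × Fin 7)
θ-edges = (# 0 , # 2) ∷ (# 2 , # 1) ∷ (# 0 , # 3) ∷ (# 3 , # 4) ∷ (# 4 , # 1) ∷ (# 0 , # 5) ∷ (# 5 , # 6) ∷ (# 6 , # 1) ∷ []

θAdj : Fin 7 → Fin 7 → Set
θAdj a b = ((a , b) ∈ₗ θ-edges) ⊎ ((b , a) ∈ₗ θ-edges)

IGraphIso : (G : Graph) (m : ℕ) → (Fin m → Fin m → Set) → Set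
IGraphIso G m HAdj =
  Σ (Fin m → Subset (Graph.n G)) λ φ →
      (∀ a → IsISet G (φ a))
    × (∀ a b → φ a ≡ φ b → a ≡ b)
    × (∀ S → IsISet G S → ∃ λ a → φ a ≡ S)
    × (∀ a b → (HAdj a b → IAdj G (φ a) (φ b)) × (IAdj G (φ a) (φ b) → HAdj a b))

-- Adjacent i-sets differ by a single swap Y = X - u + v, and conversely any two i-sets
-- differing by one swap are adjacent, because the swap is forced to run along an edge.
-- Write X₀ = S + x + p, X₂ = S + y + p, X₁ = S + y + z for the short path 0-2-1 of
-- θ_{2,3,3}.  Along a long path 0-3-4-1, the pentagon X₀ X₂ X₁ X₄ X₃ is induced, and
-- chasing memberships through it shows that the swap X₀ → X₃ must remove p.  The same
-- holds for the other long path 0-5-6-1, so X₃ and X₅ both arise from X₀ by removing p;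
-- then they are equal or differ by one swap, although 3 and 5 are distinct and
-- non-adjacent in θ_{2,3,3}.
module Submission where

open import Defs
open import Data.Nat using (ℕ)
open import Data.Fin using (Fin; #_)
open import Data.Fin.Properties using (_≟_)
open import Data.Fin.Subset using (Subset; _∈_; _∉_; _⊆_; inside; outside)
open import Data.Fin.Subset.Properties using (⊆-antisym)
open import Data.Vec using (_[_]≔_)
open import Data.Vec.Properties
  using ([]=⇒lookup; lookup⇒[]=; lookup∘update′; []≔-updates; []≔-minimal; []=-injective)
open import Data.Product using (∃; _×_; _,_; proj₁; proj₂)
open import Data.Product.Properties using (≡-dec)
open import Data.Sum using (inj₁; inj₂)
open import Data.Empty using (⊥)
open import Data.List.Membership.DecPropositional (≡-dec (_≟_ {7}) (_≟_ {7})) using (_∈?_)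
open import Relation.Nullary using (¬_; Dec; yes; no; contradiction)
open import Relation.Nullary.Decidable
  using (True; False; toWitness; toWitnessFalse; decidable-stable; _⊎-dec_)
open import Relation.Binary.PropositionalEquality using (_≡_; _≢_; ≢-sym; refl; sym; trans; subst; subst₂)

private
  variable
    n : ℕ
    A B C X Y Z : Subset n
    u v w s t : Fin n

∈∉⇒≢ : w ∈ X → t ∉ X → w ≢ t
∈∉⇒≢ w∈X t∉X refl = t∉X w∈X

-- Y = (X ∖ {u}) ∪ {v} with u ∈ X and v ∉ X: adjacency in an i-graph without the edge uv.
record Swap (X Y : Subset n) (u v : Fin n) : Set where
  field
    out∈  : u ∈ X
    in∉   : v ∉ X
    out∉  : u ∉ Y
    in∈   : v ∈ Y
    keep  : w ≢ u → w ∈ X → w ∈ Y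
    keep⁻ : w ≢ v → w ∈ Y → w ∈ X
open Swap

-- For sets of equal size, the symmetric difference has at least four elements.
Far : Subset n → Subset n → Set
Far X Y = X ≢ Y × (∀ {u v} → ¬ Swap X Y u v)

swap-sym : Swap X Y u v → Swap Y X v u
swap-sym s = record
  { out∈ = in∈ s ; in∉ = out∉ s ; out∉ = in∉ s ; in∈ = out∈ s ; keep = keep⁻ s ; keep⁻ = keep s }

swap-keeps-∉ : Swap X Y u v → w ≢ v → w ∉ X → w ∉ Y
swap-keeps-∉ s w≢v w∉X w∈Y = w∉X (keep⁻ s w≢v w∈Y)

swap-out-unique : Swap X Y u v → w ∈ X → w ∉ Y → w ≡ u
swap-out-unique {u = u} {w = w} s w∈X w∉Y =
  decidable-stable (w ≟ u) (λ w≢u → w∉Y (keep s w≢u w∈X))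

swap-in-unique : Swap X Y u v → w ∉ X → w ∈ Y → w ≡ v
swap-in-unique s w∉X w∈Y = swap-out-unique (swap-sym s) w∈Y w∉X

swap-⊆ : Swap X Y u v → Swap X Z u v → Y ⊆ Z
swap-⊆ {v = v} s t {w} w∈Y with w ≟ v
... | yes refl = in∈ t
... | no w≢v   = keep t (∈∉⇒≢ w∈Y (out∉ s)) (keep⁻ s w≢v w∈Y)

swap-functional : Swap X Y u v → Swap X Z u v → Y ≡ Z
swap-functional s t = ⊆-antisym (swap-⊆ s t) (swap-⊆ t s)

swap-update : u ∈ X → v ∉ X → Swap X ((X [ u ]≔ outside) [ v ]≔ inside) u v
swap-update {u = u} {X = X} {v = v} u∈X v∉X = record
  { out∈  = u∈X
  ; in∉   = v∉X
  ; out∉  = u∉Y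
  ; in∈   = []≔-updates (X [ u ]≔ outside) v
  ; keep  = λ {w} w≢u w∈X →
      []≔-minimal (X [ u ]≔ outside) w v (∈∉⇒≢ w∈X v∉X) ([]≔-minimal X w u w≢u w∈X)
  ; keep⁻ = back
  }
  where
  u∉Y : u ∉ (X [ u ]≔ outside) [ v ]≔ inside
  u∉Y u∈Y = contradiction
    ([]=-injective u∈Y ([]≔-minimal (X [ u ]≔ outside) u v (∈∉⇒≢ u∈X v∉X) ([]≔-updates X u)))
    λ ()
  back : w ≢ v → w ∈ (X [ u ]≔ outside) [ v ]≔ inside → w ∈ X
  back {w = w} w≢v w∈Y with w ≟ u
  ... | yes refl = contradiction w∈Y u∉Y
  ... | no w≢u   = lookup⇒[]= w X (trans
    (sym (trans (lookup∘update′ w≢v (X [ u ]≔ outside) inside) (lookup∘update′ w≢u X outside)))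
    ([]=⇒lookup w∈Y))

swap-same-out : Swap A B u v → Swap A C u t → v ≢ t → Swap B C v t
swap-same-out sB sC v≢t = record
  { out∈  = in∈ sB
  ; in∉   = swap-keeps-∉ sB (≢-sym v≢t) (in∉ sC)
  ; out∉  = swap-keeps-∉ sC v≢t (in∉ sB)
  ; in∈   = in∈ sC
  ; keep  = λ w≢v w∈B → keep sC (∈∉⇒≢ w∈B (out∉ sB)) (keep⁻ sB w≢v w∈B)
  ; keep⁻ = λ w≢t w∈C → keep sB (∈∉⇒≢ w∈C (out∉ sC)) (keep⁻ sC w≢t w∈C)
  }

swap-same-in : Swap A B u v → Swap A C s v → u ≢ s → Swap B C s u
swap-same-in {v = v} sB sC u≢s = record
  { out∈  = keep sB (≢-sym u≢s) (out∈ sC)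
  ; in∉   = out∉ sB
  ; out∉  = out∉ sC
  ; in∈   = keep sC u≢s (out∈ sB)
  ; keep  = λ w≢s w∈B → via sB sC w≢s w∈B
  ; keep⁻ = λ w≢u w∈C → via sC sB w≢u w∈C
  }
  where
  via : Swap A B u v → Swap A C s v → w ≢ s → w ∈ B → w ∈ C
  via {w = w} sB sC w≢s w∈B with w ≟ v
  ... | yes refl = in∈ sC
  ... | no w≢v   = keep sC w≢s (keep⁻ sB w≢v w∈B)

far-swaps-disjoint : Swap A B u v → Swap A C s t → Far B C → u ≢ s × v ≢ t
far-swaps-disjoint {u = u} {v = v} {s = s} {t = t} sB sC (B≢C , ¬swap) = u≢s , v≢t
  where
  u≢s : u ≢ s
  u≢s refl with v ≟ t
  ... | yes refl = B≢C (swap-functional sB sC)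
  ... | no v≢t   = ¬swap (swap-same-out sB sC v≢t)
  v≢t : v ≢ t
  v≢t refl = ¬swap (swap-same-in sB sC u≢s)

swap-undo-first : ∀ {X₀ X₁ X₂ X₄ : Subset n} {x y p z} →
                  Swap X₀ X₂ x y → Swap X₂ X₁ p z → Swap X₁ X₄ y x → y ≢ p → x ≢ z →
                  Swap X₀ X₄ p z
swap-undo-first {X₀ = X₀} {X₄ = X₄} {x = x} {p = p} {z = z} s₀₂ s₂₁ s₁₄ y≢p x≢z = record
  { out∈  = keep⁻ s₀₂ (≢-sym y≢p) (out∈ s₂₁)
  ; in∉   = swap-keeps-∉ (swap-sym s₀₂) (≢-sym x≢z) (in∉ s₂₁)
  ; out∉  = swap-keeps-∉ s₁₄ (∈∉⇒≢ (out∈ s₂₁) (out∉ s₀₂)) (out∉ s₂₁)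
  ; in∈   = keep s₁₄ (≢-sym (∈∉⇒≢ (in∈ s₀₂) (in∉ s₂₁))) (in∈ s₂₁)
  ; keep  = forward
  ; keep⁻ = backward
  }
  where
  forward : w ≢ p → w ∈ X₀ → w ∈ X₄
  forward {w = w} w≢p w∈X₀ with w ≟ x
  ... | yes refl = in∈ s₁₄
  ... | no w≢x   = keep s₁₄ (∈∉⇒≢ w∈X₀ (in∉ s₀₂)) (keep s₂₁ w≢p (keep s₀₂ w≢x w∈X₀))
  backward : w ≢ z → w ∈ X₄ → w ∈ X₀
  backward {w = w} w≢z w∈X₄ with w ≟ x
  ... | yes refl = out∈ s₀₂
  ... | no w≢x   = keep⁻ s₀₂ (∈∉⇒≢ w∈X₄ (out∉ s₁₄)) (keep⁻ s₂₁ w≢z (keep⁻ s₁₄ w≢x w∈X₄))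

module _ (G : Graph) where
  open Graph G using (E) renaming (sym to E-sym)

  IAdj⇒Swap : IAdj G X Y → ∃ λ u → ∃ λ v → Swap X Y u v × E u v
  IAdj⇒Swap (u , v , u∈X , v∉X , uv , refl) = u , v , swap-update u∈X v∉X , uv

  -- Y must dominate u ∉ Y; a neighbour of u in Y other than v would lie in X beside u ∈ X.
  Swap⇒edge : Independent G X → Dominating G Y → Swap X Y u v → E u v
  Swap⇒edge {u = u} {v = v} indX domY s with domY u
  ... | inj₁ u∈Y = contradiction u∈Y (out∉ s)
  ... | inj₂ (w , w∈Y , wu) with w ≟ v
  ...   | yes refl = E-sym wu
  ...   | no w≢v   = contradiction wu (indX w u (keep⁻ s w≢v w∈Y) (out∈ s))

  Swap⇒IAdj : Independent G X → Dominating G Y → Swap X Y u v → IAdj G X Y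
  Swap⇒IAdj indX domY s =
    _ , _ , out∈ s , in∉ s , Swap⇒edge indX domY s , swap-functional s (swap-update (out∈ s) (in∉ s))

  induced-pentagon-out : ∀ {X₀ X₁ X₂ X₃ X₄ : Subset (Graph.n G)} {x y p z a b e f c d} →
    Independent G X₄ → E x y →
    Swap X₀ X₂ x y → Swap X₂ X₁ p z → Swap X₀ X₃ a b → Swap X₃ X₄ e f → Swap X₁ X₄ c d →
    Far X₀ X₁ → Far X₂ X₃ → Far X₂ X₄ → Far X₀ X₄ → a ≡ p
  induced-pentagon-out {X₀} {X₁} {X₂} {X₃} {X₄} {x} {y} {p} {z} {a} {b} {e} {f} {c} {d}
      indX₄ xy s₀₂ s₂₁ s₀₃ s₃₄ s₁₄ far₀₁ far₂₃ far₂₄ far₀₄ =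
    decidable-stable (a ≟ p) absurd
    where
    y≢p : y ≢ p
    y≢p = proj₁ (far-swaps-disjoint (swap-sym s₀₂) s₂₁ far₀₁)
    x≢z : x ≢ z
    x≢z = proj₂ (far-swaps-disjoint (swap-sym s₀₂) s₂₁ far₀₁)
    x≢a : x ≢ a
    x≢a = proj₁ (far-swaps-disjoint s₀₂ s₀₃ far₂₃)
    y≢b : y ≢ b
    y≢b = proj₂ (far-swaps-disjoint s₀₂ s₀₃ far₂₃)
    p≢d : p ≢ d
    p≢d = proj₂ (far-swaps-disjoint (swap-sym s₂₁) s₁₄ far₂₄)
    a≢y : a ≢ y
    a≢y = ∈∉⇒≢ (out∈ s₀₃) (in∉ s₀₂)
    y∈X₁ : y ∈ X₁
    y∈X₁ = keep s₂₁ y≢p (in∈ s₀₂)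

    -- If a ≢ p, then p leaves at X₃ → X₄ and x enters at X₁ → X₄.  The vertex c leaving X₁
    -- is then a, which puts the adjacent x and y into X₄, or y, which makes X₄ = X₀ - p + z.
    absurd : ¬ a ≢ p
    absurd a≢p = by-cases (a ≟ c)
      where
      p≡e : p ≡ e
      p≡e = swap-out-unique s₃₄ (keep s₀₃ (≢-sym a≢p) (keep⁻ s₀₂ (≢-sym y≢p) (out∈ s₂₁)))
                                (swap-keeps-∉ s₁₄ p≢d (out∉ s₂₁))
      x∈X₄ : x ∈ X₄
      x∈X₄ = keep s₃₄ (subst (x ≢_) p≡e (≢-sym (∈∉⇒≢ (out∈ s₂₁) (out∉ s₀₂)))) (keep s₀₃ x≢a (out∈ s₀₂))
      x≡d : x ≡ d
      x≡d = swap-in-unique s₁₄ (swap-keeps-∉ s₂₁ x≢z (out∉ s₀₂)) x∈X₄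
      by-cases : Dec (a ≡ c) → ⊥
      by-cases (yes a≡c) = indX₄ x y x∈X₄ (keep s₁₄ (subst (y ≢_) a≡c (≢-sym a≢y)) y∈X₁) xy
      by-cases (no a≢c)  =
        proj₂ far₀₄ (swap-undo-first s₀₂ s₂₁ (subst₂ (Swap X₁ X₄) (sym y≡c) (sym x≡d) s₁₄) y≢p x≢z)
        where
        a≡f : a ≡ f
        a≡f = swap-in-unique s₃₄ (out∉ s₀₃) (keep s₁₄ a≢c (keep s₂₁ a≢p (keep s₀₂ (≢-sym x≢a) (out∈ s₀₃))))
        y≡c : y ≡ c
        y≡c = decidable-stable (y ≟ c) λ y≢c →
          a≢y (trans a≡f (sym (swap-in-unique s₃₄ (swap-keeps-∉ s₀₃ y≢b (in∉ s₀₂)) (keep s₁₄ y≢c y∈X₁))))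

θAdj? : ∀ i j → Dec (θAdj i j)
θAdj? i j = ((i , j) ∈? θ-edges) ⊎-dec ((j , i) ∈? θ-edges)

mainTheorem7 : (G : Graph) → ¬ IGraphIso G 7 θAdj
mainTheorem7 G (X , isISet , injective , _ , iadj) =
  let _ , _ , s₀₂ , xy = swap-along (# 0) (# 2)
      _ , _ , s₂₁ , _  = swap-along (# 2) (# 1)
      _ , _ , s₀₃ , _  = swap-along (# 0) (# 3)
      _ , _ , s₃₄ , _  = swap-along (# 3) (# 4)
      _ , _ , s₁₄ , _  = swap-along (# 1) (# 4)
      _ , _ , s₀₅ , _  = swap-along (# 0) (# 5)
      _ , _ , s₅₆ , _  = swap-along (# 5) (# 6)
      _ , _ , s₁₆ , _  = swap-along (# 1) (# 6)
      a≡p   = induced-pentagon-out G (independent (# 4)) xy s₀₂ s₂₁ s₀₃ s₃₄ s₁₄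
               (far (# 0) (# 1)) (far (# 2) (# 3)) (far (# 2) (# 4)) (far (# 0) (# 4))
      a′≡p  = induced-pentagon-out G (independent (# 6)) xy s₀₂ s₂₁ s₀₅ s₅₆ s₁₆
               (far (# 0) (# 1)) (far (# 2) (# 5)) (far (# 2) (# 6)) (far (# 0) (# 6))
  in proj₁ (far-swaps-disjoint s₀₃ s₀₅ (far (# 3) (# 5))) (trans a≡p (sym a′≡p))
  where
  open Graph G using (E)

  independent : ∀ i → Independent G (X i)
  independent i = proj₁ (proj₁ (isISet i))

  dominating : ∀ i → Dominating G (X i)
  dominating i = proj₂ (proj₁ (isISet i))

  swap-along : ∀ i j → {True (θAdj? i j)} → ∃ λ u → ∃ λ v → Swap (X i) (X j) u v × E u v
  swap-along i j {i~j} = IAdj⇒Swap G (proj₁ (iadj i j) (toWitness i~j))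

  far : ∀ i j → {False (i ≟ j)} → {False (θAdj? i j)} → Far (X i) (X j)
  far i j {i≢j} {i≁j} =
      (λ Xi≡Xj → toWitnessFalse i≢j (injective i j Xi≡Xj))
    , λ s → toWitnessFalse i≁j (proj₂ (iadj i j) (Swap⇒IAdj G (independent i) (dominating j) s))
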